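{- For every field $K$, every $n\ge1$, and every $\varepsilon\in(0,1)$, the function $LEQ_n$ has $\varepsilon$-probabilistic rank at most $O(n^2/\varepsilon)$ over $K$ (absolute implied constant).
   Context: $LEQ_n:\{0,1\}^n\times\{0,1\}^n\to\{0,1\}$ is $LEQ_n(x,y)=1$ if $x\le y$ and $0$ otherwise, where $x,y$ are interpreted as integers in $\{0,\dots,2^n-1\}$ written in binary. The truth table matrix of $g:\{0,1\}^n\times\{0,1\}^n\to K$ is the $2^n\times2^n$ matrix with entry $g(x,y)$ at row $x$, column $y$; the probabilistic rank of $g$ is that of this matrix. A probabilistic matrix over $K$ is a probability distribution $\mathcal{M}$ on matrices over $K$ of a fixed size; it has rank at most $r$ if every matrix in its support has rank at most $r$; it computes $A$ with error $\varepsilon$ if for every entry $(i,j)$, $\Pr_{B\sim\mathcal{M}}[B_{ij}=A_{ij}]\ge1-\varepsilon$. The $\varepsilon$-probabilistic rank of $A$ over $K$ is the minimum $r$ such that some probabilistic matrix of rank at most $r$ computes $A$ with error $\varepsilon$.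
   Formalization: The error parameter ε ranges only over rational numbers in the interval (0,1). -}

module Defs where

open import Level using (Level; _⊔_; Setω) renaming (suc to lsuc)
open import Algebra.Bundles using (CommutativeRing)
open import Data.Nat as ℕ using (ℕ; zero; suc; _^_; _≤ᵇ_; NonZero)
open import Data.Fin as Fin using (Fin; toℕ)
open import Data.Fin.Subset using (Subset; _∈_; ∣_∣)
open import Data.Bool using (if_then_else_)
open import Data.Integer using (+_)
open import Data.Rational as ℚ using (ℚ; _/_; 1ℚ; 0ℚ)
open import Data.Product using (Σ; ∃; _×_)
open import Relation.Nullary using (¬_)

⟦_⟧ : ℕ → ℚ
⟦ n ⟧ = + n / 1

record Field (c ℓ : Level) : Set (lsuc (c ⊔ ℓ)) where
  field
    commutativeRing : CommutativeRing c ℓ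
  open CommutativeRing commutativeRing public
  field
    0≉1     : ¬ (0# ≈ 1#)
    inverse : ∀ x → ¬ (x ≈ 0#) → ∃ λ y → (x * y) ≈ 1#

module _ {c ℓ : Level} (K : Field c ℓ) where
  open Field K

  Matrix : ℕ → ℕ → Set c
  Matrix m n = Fin m → Fin n → Carrier

  sumK : (r : ℕ) → (Fin r → Carrier) → Carrier
  sumK zero    f = 0#
  sumK (suc r) f = f Fin.zero + sumK r (λ k → f (Fin.suc k))

  RankAtMost : {m n : ℕ} → Matrix m n → ℕ → Set (c ⊔ ℓ)
  RankAtMost {m} {n} A r =
    Σ (Matrix m r) λ U → Σ (Matrix r n) λ V →
      ∀ i j → A i j ≈ sumK r (λ k → U i k * V k j)

  -- A probabilistic matrix of rank ≤ r computing A with error ε: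
  -- a uniform distribution over a finite nonempty list M₀,…,M_{N-1} of matrices
  -- (= a finitely supported distribution with rational weights), each of rank ≤ r,
  -- such that for every entry (i,j) the set of indices k with (M_k)ᵢⱼ = Aᵢⱼ has
  -- size at least (1 - ε)·N, i.e. Pr[Bᵢⱼ = Aᵢⱼ] ≥ 1 - ε.
  ProbRankAtMost : {m n : ℕ} → Matrix m n → ℚ → ℕ → Set (c ⊔ ℓ)
  ProbRankAtMost {m} {n} A ε r =
    Σ ℕ λ N → NonZero N × Σ (Fin N → Matrix m n) λ M →
      (∀ k → RankAtMost (M k) r) ×
      (∀ i j → Σ (Subset N) λ S →
         (∀ k → k ∈ S → M k i j ≈ A i j) × ((1ℚ ℚ.- ε) ℚ.* ⟦ N ⟧ ℚ.≤ ⟦ ∣ S ∣ ⟧))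

  LEQ : (n : ℕ) → Matrix (2 ^ n) (2 ^ n)
  LEQ n x y = if toℕ x ≤ᵇ toℕ y then 1# else 0#

-- The claimed bound with an absolute constant C:
-- for all fields K, n ≥ 1, ε ∈ (0,1): ε-probabilistic rank of LEQ_n ≤ C · n² / ε,
-- i.e. there is r with r · ε ≤ C · n² and a probabilistic matrix of rank ≤ r.
record LEQBound : Setω where
  field
    C     : ℕ
    bound : ∀ {c ℓ} (K : Field c ℓ) (n : ℕ) → 1 ℕ.≤ n →
            (ε : ℚ) → 0ℚ ℚ.< ε → ε ℚ.< 1ℚ →
            Σ ℕ λ r → (⟦ r ⟧ ℚ.* ε ℚ.≤ ⟦ C ℕ.* (n ℕ.* n) ⟧) × ProbRankAtMost K (LEQ K n) ε r

module Submission where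

-- For x ≤ y < 2ⁿ there is exactly one level ℓ ≤ n at which x and y "split": either ℓ = 0
-- and x = y, or x and y agree on all bits above position ℓ-1 while bit ℓ-1 is 0 in x and 1
-- in y; for x > y there is none.  Hence LEQ(x,y) = ∑_ℓ [x≫ℓ = y≫ℓ]·low_ℓ(x)·high_ℓ(y).
-- Replacing each equality test [u = v] of prefixes by ∑_{s<t} [h u = s]·[h v = s] for a
-- hash function h : Fin 2ⁿ → Fin t gives a matrix of rank (n+1)·t, which equals LEQ at
-- (x,y) unless h collides on one of the n+1 pairs of distinct prefixes of x and y.  Drawing
-- h uniformly among all t^(2ⁿ) functions, each collision has probability at most 1/t, so by
-- the union bound the error is at most (n+1)/t ≤ ε for t = ⌊(n+1)/ε⌋ + 1; the rank is then
-- (n+1)·t ≤ 6n²/ε.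

open import Defs
open import Data.Nat using (ℕ)

module NaturalsInRationals where
  open import Data.Nat as ℕ using (ℕ; suc)
  import Data.Nat.Properties as ℕP
  open import Data.Integer as ℤ using (+_)
  import Data.Integer.Properties as ℤP
  open import Data.Rational as ℚ using (mkℚ; 1ℚ; toℚᵘ)
  import Data.Rational.Properties as ℚP
  open import Data.Rational.Unnormalised as ℚᵘ using (mkℚᵘ; *≡*; *≤*)
  import Data.Rational.Unnormalised.Properties as ℚᵘP
  open import Data.Rational.Solver using (module +-*-Solver)
  open import Data.Nat.Coprimality using (Coprime; 1-coprimeTo) renaming (sym to coprime-sym)
  open import Relation.Binary.PropositionalEquality

  ⟦⟧-normal : ∀ n → ⟦ n ⟧ ≡ mkℚ (+ n) 0 (coprime-sym (1-coprimeTo n))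
  ⟦⟧-normal n = ℚP.normalize-coprime (coprime-sym (1-coprimeTo n))

  toℚᵘ-⟦⟧ : ∀ n → toℚᵘ ⟦ n ⟧ ≡ mkℚᵘ (+ n) 0
  toℚᵘ-⟦⟧ n = cong toℚᵘ (⟦⟧-normal n)

  ⟦⟧-+ : ∀ x y → ⟦ x ⟧ ℚ.+ ⟦ y ⟧ ≡ ⟦ x ℕ.+ y ⟧
  ⟦⟧-+ x y = ℚP.toℚᵘ-injective (begin
      toℚᵘ (⟦ x ⟧ ℚ.+ ⟦ y ⟧)          ≈⟨ ℚP.toℚᵘ-homo-+ ⟦ x ⟧ ⟦ y ⟧ ⟩
      toℚᵘ ⟦ x ⟧ ℚᵘ.+ toℚᵘ ⟦ y ⟧      ≡⟨ cong₂ ℚᵘ._+_ (toℚᵘ-⟦⟧ x) (toℚᵘ-⟦⟧ y) ⟩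
      mkℚᵘ (+ x) 0 ℚᵘ.+ mkℚᵘ (+ y) 0  ≈⟨ *≡* (cong (ℤ._* + 1) (cong₂ ℤ._+_ (ℤP.*-identityʳ (+ x))
                                                                        (ℤP.*-identityʳ (+ y)))) ⟩
      mkℚᵘ (+ x ℤ.+ + y) 0             ≡⟨ cong (λ z → mkℚᵘ z 0) (sym (ℤP.pos-+ x y)) ⟩
      mkℚᵘ (+ (x ℕ.+ y)) 0             ≡⟨ sym (toℚᵘ-⟦⟧ (x ℕ.+ y)) ⟩
      toℚᵘ ⟦ x ℕ.+ y ⟧                 ∎)
    where open ℚᵘP.≃-Reasoning

  ⟦⟧-* : ∀ x y → ⟦ x ⟧ ℚ.* ⟦ y ⟧ ≡ ⟦ x ℕ.* y ⟧
  ⟦⟧-* x y = ℚP.toℚᵘ-injective (begin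
      toℚᵘ (⟦ x ⟧ ℚ.* ⟦ y ⟧)          ≈⟨ ℚP.toℚᵘ-homo-* ⟦ x ⟧ ⟦ y ⟧ ⟩
      toℚᵘ ⟦ x ⟧ ℚᵘ.* toℚᵘ ⟦ y ⟧      ≡⟨ cong₂ ℚᵘ._*_ (toℚᵘ-⟦⟧ x) (toℚᵘ-⟦⟧ y) ⟩
      mkℚᵘ (+ x ℤ.* + y) 0             ≡⟨ cong (λ z → mkℚᵘ z 0) (sym (ℤP.pos-* x y)) ⟩
      mkℚᵘ (+ (x ℕ.* y)) 0             ≡⟨ sym (toℚᵘ-⟦⟧ (x ℕ.* y)) ⟩
      toℚᵘ ⟦ x ℕ.* y ⟧                 ∎)
    where open ℚᵘP.≃-Reasoning

  ⟦⟧-mono-≤ : ∀ {x y} → x ℕ.≤ y → ⟦ x ⟧ ℚ.≤ ⟦ y ⟧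
  ⟦⟧-mono-≤ {x} {y} x≤y = ℚP.toℚᵘ-cancel-≤ (subst₂ ℚᵘ._≤_ (sym (toℚᵘ-⟦⟧ x)) (sym (toℚᵘ-⟦⟧ y))
    (*≤* (subst₂ ℤ._≤_ (ℤP.pos-* x 1) (ℤP.pos-* y 1) (ℤ.+≤+ (ℕP.*-monoˡ-≤ 1 x≤y)))))

  denominator-clears : ∀ a d-1 .(c : Coprime a (suc d-1)) → ⟦ suc d-1 ⟧ ℚ.* mkℚ (+ a) d-1 c ≡ ⟦ a ⟧
  denominator-clears a d-1 c = ℚP.toℚᵘ-injective (begin
      toℚᵘ (⟦ suc d-1 ⟧ ℚ.* mkℚ (+ a) d-1 c)  ≈⟨ ℚP.toℚᵘ-homo-* ⟦ suc d-1 ⟧ (mkℚ (+ a) d-1 c) ⟩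
      toℚᵘ ⟦ suc d-1 ⟧ ℚᵘ.* mkℚᵘ (+ a) d-1    ≡⟨ cong (ℚᵘ._* mkℚᵘ (+ a) d-1) (toℚᵘ-⟦⟧ (suc d-1)) ⟩
      mkℚᵘ (+ suc d-1) 0 ℚᵘ.* mkℚᵘ (+ a) d-1   ≈⟨ *≡* cross-multiplied ⟩
      mkℚᵘ (+ a) 0                              ≡⟨ sym (toℚᵘ-⟦⟧ a) ⟩
      toℚᵘ ⟦ a ⟧                                ∎)
    where
    open ℚᵘP.≃-Reasoning
    cross-multiplied : (+ suc d-1 ℤ.* + a) ℤ.* + 1 ≡ + a ℤ.* + suc (d-1 ℕ.+ 0)
    cross-multiplied rewrite ℕP.+-identityʳ d-1 | ℤP.*-identityʳ (+ suc d-1 ℤ.* + a) =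
      ℤP.*-comm (+ suc d-1) (+ a)

  numerator-< : ∀ a d-1 .(c : Coprime a (suc d-1)) → mkℚ (+ a) d-1 c ℚ.< 1ℚ → a ℕ.< suc d-1
  numerator-< a d-1 c (ℚ.*<* a·1<1·d) =
    subst₂ ℕ._<_ (ℕP.*-identityʳ a) (ℕP.*-identityˡ (suc d-1))
      (ℤP.drop‿+<+ (subst₂ ℤ._<_ (sym (ℤP.pos-* a 1)) (sym (ℤP.pos-* 1 (suc d-1))) a·1<1·d))

  module _ (a d-1 : ℕ) .(c : Coprime a (suc d-1)) where
    private
      ε = mkℚ (+ a) d-1 c
      d = ⟦ suc d-1 ⟧
      instance
        d-positive : ℚ.Positive d
        d-positive = subst ℚ.Positive (sym (⟦⟧-normal (suc d-1))) _
    open +-*-Solver using (solve; _:+_; _:*_; _:-_; _:=_; con)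

    scaled-bound : ∀ r m → r ℕ.* a ℕ.≤ m ℕ.* suc d-1 → ⟦ r ⟧ ℚ.* ε ℚ.≤ ⟦ m ⟧
    scaled-bound r m ra≤md = ℚP.*-cancelˡ-≤-pos d (begin
      d ℚ.* (⟦ r ⟧ ℚ.* ε)   ≡⟨ solve 3 (λ d r e → d :* (r :* e) := r :* (d :* e)) refl d ⟦ r ⟧ ε ⟩
      ⟦ r ⟧ ℚ.* (d ℚ.* ε)   ≡⟨ cong (⟦ r ⟧ ℚ.*_) (denominator-clears a d-1 c) ⟩
      ⟦ r ⟧ ℚ.* ⟦ a ⟧       ≡⟨ ⟦⟧-* r a ⟩
      ⟦ r ℕ.* a ⟧           ≤⟨ ⟦⟧-mono-≤ ra≤md ⟩
      ⟦ m ℕ.* suc d-1 ⟧     ≡⟨ cong ⟦_⟧ (ℕP.*-comm m (suc d-1)) ⟩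
      ⟦ suc d-1 ℕ.* m ⟧     ≡⟨ sym (⟦⟧-* (suc d-1) m) ⟩
      d ℚ.* ⟦ m ⟧           ∎)
      where open ℚP.≤-Reasoning

    complement-bound : ∀ s b N → s ℕ.+ b ≡ N → b ℕ.* suc d-1 ℕ.≤ a ℕ.* N →
                       (1ℚ ℚ.- ε) ℚ.* ⟦ N ⟧ ℚ.≤ ⟦ s ⟧
    complement-bound s b N s+b≡N bd≤aN = ℚP.*-cancelˡ-≤-pos d (begin
      d ℚ.* ((1ℚ ℚ.- ε) ℚ.* ⟦ N ⟧)
        ≡⟨ solve 3 (λ d e n → d :* ((con 1ℚ :- e) :* n) := d :* n :- (d :* e) :* n) refl d ε ⟦ N ⟧ ⟩
      d ℚ.* ⟦ N ⟧ ℚ.- (d ℚ.* ε) ℚ.* ⟦ N ⟧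
        ≡⟨ cong (λ z → d ℚ.* ⟦ N ⟧ ℚ.- z ℚ.* ⟦ N ⟧) (denominator-clears a d-1 c) ⟩
      d ℚ.* ⟦ N ⟧ ℚ.- ⟦ a ⟧ ℚ.* ⟦ N ⟧
        ≡⟨ cong (λ z → d ℚ.* ⟦ N ⟧ ℚ.- z) (⟦⟧-* a N) ⟩
      d ℚ.* ⟦ N ⟧ ℚ.- ⟦ a ℕ.* N ⟧
        ≤⟨ ℚP.+-monoʳ-≤ (d ℚ.* ⟦ N ⟧) (ℚP.neg-antimono-≤ (⟦⟧-mono-≤ bd≤aN)) ⟩
      d ℚ.* ⟦ N ⟧ ℚ.- ⟦ b ℕ.* suc d-1 ⟧
        ≡⟨ cong₂ (λ u v → d ℚ.* u ℚ.- v) (cong ⟦_⟧ (sym s+b≡N)) (sym (⟦⟧-* b (suc d-1))) ⟩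
      d ℚ.* ⟦ s ℕ.+ b ⟧ ℚ.- ⟦ b ⟧ ℚ.* d
        ≡⟨ cong (λ u → d ℚ.* u ℚ.- ⟦ b ⟧ ℚ.* d) (sym (⟦⟧-+ s b)) ⟩
      d ℚ.* (⟦ s ⟧ ℚ.+ ⟦ b ⟧) ℚ.- ⟦ b ⟧ ℚ.* d
        ≡⟨ solve 3 (λ d s b → d :* (s :+ b) :- b :* d := d :* s) refl d ⟦ s ⟧ ⟦ b ⟧ ⟩
      d ℚ.* ⟦ s ⟧ ∎)
      where open ℚP.≤-Reasoning

module Counting where
  open import Data.Nat using (ℕ; zero; suc; _+_; _*_; _≤_; z≤n; s≤s)
  import Data.Nat.Properties as ℕP
  open import Data.Fin using (Fin; zero; suc; _↑ˡ_; _↑ʳ_; combine)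
  open import Data.Fin.Properties as FinP using (_≟_)
  open import Data.Fin.Subset using (_∈_; ∣_∣)
  open import Data.Bool using (Bool; true; false; if_then_else_; not; _∨_; T)
  open import Data.Bool.Properties using (T-∨)
  open import Data.Sum using (inj₁; inj₂)
  open import Data.Vec using (tabulate)
  import Data.Vec.Properties as VecP
  open import Function using (Equivalence)
  open import Relation.Nullary.Decidable using (⌊_⌋; ⌊⌋-map′)
  open import Relation.Binary.PropositionalEquality

  sumF : (m : ℕ) → (Fin m → ℕ) → ℕ
  sumF zero    f = 0
  sumF (suc m) f = f zero + sumF m (λ k → f (suc k))

  count : (m : ℕ) → (Fin m → Bool) → ℕ
  count m P = sumF m (λ k → if P k then 1 else 0)

  sumF-cong : ∀ m {f g : Fin m → ℕ} → (∀ k → f k ≡ g k) → sumF m f ≡ sumF m g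
  sumF-cong zero    f≗g = refl
  sumF-cong (suc m) f≗g = cong₂ _+_ (f≗g zero) (sumF-cong m (λ k → f≗g (suc k)))

  count-cong : ∀ m {P Q : Fin m → Bool} → (∀ k → P k ≡ Q k) → count m P ≡ count m Q
  count-cong m P≗Q = sumF-cong m (λ k → cong (λ b → if b then 1 else 0) (P≗Q k))

  sumF-++ : ∀ m p (f : Fin (m + p) → ℕ) →
            sumF (m + p) f ≡ sumF m (λ i → f (i ↑ˡ p)) + sumF p (λ j → f (m ↑ʳ j))
  sumF-++ zero    p f = refl
  sumF-++ (suc m) p f = trans (cong (f zero +_) (sumF-++ m p (λ k → f (suc k))))
                              (sym (ℕP.+-assoc (f zero) _ _))

  sumF-combine : ∀ m p (f : Fin (m * p) → ℕ) →
                 sumF (m * p) f ≡ sumF m (λ i → sumF p (λ j → f (combine i j)))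
  sumF-combine zero    p f = refl
  sumF-combine (suc m) p f = trans (sumF-++ p (m * p) f)
    (cong (sumF p (λ j → f (j ↑ˡ (m * p))) +_) (sumF-combine m p (λ k → f (p ↑ʳ k))))

  sumF-bound : ∀ m t X (f : Fin m → ℕ) → (∀ i → f i * t ≤ X) → sumF m f * t ≤ m * X
  sumF-bound zero    t X f bd = z≤n
  sumF-bound (suc m) t X f bd = ℕP.≤-trans (ℕP.≤-reflexive (ℕP.*-distribʳ-+ t (f zero) _))
    (ℕP.+-mono-≤ (bd zero) (sumF-bound m t X (λ i → f (suc i)) (λ i → bd (suc i))))

  count-const : ∀ m b → count m (λ _ → b) ≡ (if b then m else 0)
  count-const zero    true  = refl
  count-const zero    false = refl
  count-const (suc m) true  = cong suc (count-const m true)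
  count-const (suc m) false = count-const m false

  sumF-point : ∀ m (s : Fin m) X → sumF m (λ i → if ⌊ i ≟ s ⌋ then X else 0) ≡ X
  sumF-point (suc m) zero    X = trans (cong (X +_) (count-const m false)) (ℕP.+-identityʳ X)
  sumF-point (suc m) (suc s) X =
    trans (sumF-cong m λ i → cong (λ b → if b then X else 0) (⌊⌋-map′ (cong suc) FinP.suc-injective (i ≟ s)))
          (sumF-point m s X)

  count-mono : ∀ m {P Q : Fin m → Bool} → (∀ k → T (P k) → T (Q k)) → count m P ≤ count m Q
  count-mono zero    P⇒Q = z≤n
  count-mono (suc m) {P} {Q} P⇒Q with P zero in eqP | Q zero in eqQ
  ... | true  | true  = s≤s (count-mono m (λ k → P⇒Q (suc k)))
  ... | false | true  = ℕP.m≤n⇒m≤1+n (count-mono m (λ k → P⇒Q (suc k)))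
  ... | false | false = count-mono m (λ k → P⇒Q (suc k))
  ... | true  | false with () ← subst T eqQ (P⇒Q zero (subst T (sym eqP) _))

  count-∨ : ∀ m (P Q : Fin m → Bool) → count m (λ k → P k ∨ Q k) ≤ count m P + count m Q
  count-∨ zero    P Q = z≤n
  count-∨ (suc m) P Q with P zero | Q zero
  ... | true  | true  = s≤s (ℕP.≤-trans (count-∨ m _ _)
                                        (ℕP.+-monoʳ-≤ (count m (λ k → P (suc k))) (ℕP.n≤1+n _)))
  ... | true  | false = s≤s (count-∨ m _ _)
  ... | false | true  = ℕP.≤-trans (s≤s (count-∨ m _ _)) (ℕP.≤-reflexive (sym (ℕP.+-suc _ _)))
  ... | false | false = count-∨ m _ _

  anyF : (L : ℕ) → (Fin L → Bool) → Bool
  anyF zero    f = false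
  anyF (suc L) f = f zero ∨ anyF L (λ l → f (suc l))

  anyF-intro : ∀ L (f : Fin L → Bool) l → T (f l) → T (anyF L f)
  anyF-intro (suc L) f zero    fl = Equivalence.from T-∨ (inj₁ fl)
  anyF-intro (suc L) f (suc l) fl = Equivalence.from T-∨ (inj₂ (anyF-intro L (λ l → f (suc l)) l fl))

  count-anyF : ∀ N L (B : Fin N → Fin L → Bool) →
               count N (λ k → anyF L (B k)) ≤ sumF L (λ l → count N (λ k → B k l))
  count-anyF N zero    B = ℕP.≤-reflexive (count-const N false)
  count-anyF N (suc L) B = ℕP.≤-trans (count-∨ N _ _)
    (ℕP.+-monoʳ-≤ (count N (λ k → B k zero)) (count-anyF N L (λ k l → B k (suc l))))

  count-not : ∀ m (P : Fin m → Bool) → count m (λ k → not (P k)) + count m P ≡ m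
  count-not zero    P = refl
  count-not (suc m) P with P zero
  ... | true  = trans (ℕP.+-suc _ _) (cong suc (count-not m _))
  ... | false = cong suc (count-not m _)

  ∈-tabulate : ∀ {m} (P : Fin m → Bool) k → k ∈ tabulate P → T (P k)
  ∈-tabulate P k k∈P = subst T (trans (sym (VecP.[]=⇒lookup k∈P)) (VecP.lookup∘tabulate P k)) _

  ∣tabulate∣ : ∀ m (P : Fin m → Bool) → ∣ tabulate P ∣ ≡ count m P
  ∣tabulate∣ zero    P = refl
  ∣tabulate∣ (suc m) P with P zero
  ... | true  = cong suc (∣tabulate∣ m (λ k → P (suc k)))
  ... | false = ∣tabulate∣ m (λ k → P (suc k))

-- The uniform hash family: Fin (t ^ D) enumerates all functions Fin D → Fin t
-- (Data.Fin.finToFun).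
module UniformHashing (t : ℕ) where
  open Counting
  open import Data.Nat using (ℕ; zero; suc; _*_; _^_; _≤_)
  import Data.Nat.Properties as ℕP
  open import Data.Fin using (Fin; zero; suc; combine; finToFun)
  open import Data.Fin.Properties using (_≟_; remQuot-combine)
  open import Data.Bool using (Bool; if_then_else_)
  open import Data.Product using (proj₁; proj₂)
  open import Function using (mk⇔)
  open import Relation.Nullary using (¬_)
  open import Relation.Nullary.Decidable using (⌊_⌋; isYes≗does; does-⇔)
  open import Relation.Binary.PropositionalEquality

  hash : ∀ {D} → Fin (t ^ D) → Fin D → Fin t
  hash = finToFun

  hash-combine-zero : ∀ D (i : Fin t) (j : Fin (t ^ D)) → hash (combine i j) (zero {D}) ≡ i
  hash-combine-zero D i j = cong proj₁ (remQuot-combine {n = t} {k = t ^ D} i j)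

  hash-combine-suc : ∀ D (i : Fin t) (j : Fin (t ^ D)) (u : Fin D) →
                     hash (combine i j) (suc u) ≡ hash j u
  hash-combine-suc D i j u = cong (λ p → hash (proj₂ p) u) (remQuot-combine {n = t} {k = t ^ D} i j)

  ≟-sym : ∀ {m} (i j : Fin m) → ⌊ i ≟ j ⌋ ≡ ⌊ j ≟ i ⌋
  ≟-sym i j = trans (isYes≗does (i ≟ j))
    (trans (does-⇔ (mk⇔ sym sym) (i ≟ j) (j ≟ i)) (sym (isYes≗does (j ≟ i))))

  frequency-cong : ∀ m {P Q : Fin m → Bool} {X} → (∀ k → P k ≡ Q k) →
                   count m Q * t ≤ X → count m P * t ≤ X
  frequency-cong m P≗Q = subst (λ c → c * t ≤ _) (sym (count-cong m P≗Q))

  -- A hash function on Fin (suc D) is a value at zero combined with a hash function on the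
  -- remaining points; a frequency bound on every slice with fixed value at zero is global.
  count-by-first-value : ∀ D (P : Fin (t ^ suc D) → Bool) →
    (∀ i → count (t ^ D) (λ j → P (combine i j)) * t ≤ t ^ D) →
    count (t ^ suc D) P * t ≤ t ^ suc D
  count-by-first-value D P slice = ℕP.≤-trans
    (ℕP.≤-reflexive (cong (_* t) (sumF-combine t (t ^ D) (λ k → if P k then 1 else 0))))
    (sumF-bound t t (t ^ D) _ slice)

  hash-uniform : ∀ D (u : Fin D) (s : Fin t) → count (t ^ D) (λ k → ⌊ hash k u ≟ s ⌋) * t ≤ t ^ D
  hash-uniform (suc D) zero s = ℕP.≤-reflexive (begin
      count (t * t ^ D) (λ k → ⌊ hash k (zero {D}) ≟ s ⌋) * t
        ≡⟨ cong (_* t) (sumF-combine t (t ^ D) _) ⟩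
      sumF t (λ i → count (t ^ D) (λ j → ⌊ hash (combine i j) (zero {D}) ≟ s ⌋)) * t
        ≡⟨ cong (_* t) (sumF-cong t λ i → count-cong (t ^ D) λ j →
             cong (λ v → ⌊ v ≟ s ⌋) (hash-combine-zero D i j)) ⟩
      sumF t (λ i → count (t ^ D) (λ _ → ⌊ i ≟ s ⌋)) * t
        ≡⟨ cong (_* t) (sumF-cong t λ i → count-const (t ^ D) ⌊ i ≟ s ⌋) ⟩
      sumF t (λ i → if ⌊ i ≟ s ⌋ then t ^ D else 0) * t
        ≡⟨ cong (_* t) (sumF-point t s (t ^ D)) ⟩
      t ^ D * t
        ≡⟨ ℕP.*-comm (t ^ D) t ⟩
      t * t ^ D ∎)
    where open ≡-Reasoning
  hash-uniform (suc D) (suc u) s = count-by-first-value D _ λ i →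
    frequency-cong (t ^ D) (λ j → cong (λ v → ⌊ v ≟ s ⌋) (hash-combine-suc D i j u))
      (hash-uniform D u s)

  hash-collision : ∀ D (u v : Fin D) → ¬ u ≡ v →
    count (t ^ D) (λ k → ⌊ hash k u ≟ hash k v ⌋) * t ≤ t ^ D
  hash-collision (suc D) zero zero u≢v with () ← u≢v refl
  hash-collision (suc D) zero (suc v) _ = count-by-first-value D _ λ i →
    frequency-cong (t ^ D)
      (λ j → trans (cong₂ (λ p q → ⌊ p ≟ q ⌋) (hash-combine-zero D i j) (hash-combine-suc D i j v))
                   (≟-sym i (hash j v)))
      (hash-uniform D v i)
  hash-collision (suc D) (suc u) zero u≢v =
    frequency-cong (t ^ suc D) (λ k → ≟-sym (hash k (suc u)) (hash k (zero {D})))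
      (hash-collision (suc D) zero (suc u) (λ e → u≢v (sym e)))
  hash-collision (suc D) (suc u) (suc v) u≢v = count-by-first-value D _ λ i →
    frequency-cong (t ^ D)
      (λ j → cong₂ (λ p q → ⌊ p ≟ q ⌋) (hash-combine-suc D i j u) (hash-combine-suc D i j v))
      (hash-collision D u v (λ e → u≢v (cong suc e)))

module BinaryPrefixes where
  open import Data.Nat using (ℕ; zero; suc; _+_; _*_; _^_; _≤_; _<_; _/_; _%_; z≤n; s≤s; _≟_)
  import Data.Nat.Properties as ℕP
  import Data.Nat.DivMod as ℕD
  open import Data.Unit using (⊤; tt)
  open import Data.Sum using (inj₁; inj₂)
  open import Data.Product using (Σ; _×_; _,_; proj₁; proj₂)
  open import Relation.Nullary using (Dec; yes; no; ¬_)
  open import Relation.Binary using (tri<; tri≈; tri>)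
  open import Relation.Binary.PropositionalEquality

  prefix : ℕ → ℕ → ℕ
  prefix zero    x = x
  prefix (suc ℓ) x = prefix ℓ x / 2

  bit : ℕ → ℕ → ℕ
  bit ℓ x = prefix ℓ x % 2

  prefix-digits : ∀ ℓ x → prefix ℓ x ≡ bit ℓ x + prefix (suc ℓ) x * 2
  prefix-digits ℓ x = ℕD.m≡m%n+[m/n]*n (prefix ℓ x) 2

  prefix-mono : ∀ ℓ {x y} → x ≤ y → prefix ℓ x ≤ prefix ℓ y
  prefix-mono zero    x≤y = x≤y
  prefix-mono (suc ℓ) x≤y = ℕD./-monoˡ-≤ 2 (prefix-mono ℓ x≤y)

  prefix-≤ : ∀ ℓ x → prefix ℓ x ≤ x
  prefix-≤ zero    x = ℕP.≤-refl
  prefix-≤ (suc ℓ) x = ℕP.≤-trans (ℕD.m/n≤m (prefix ℓ x) 2) (prefix-≤ ℓ x)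

  prefix-< : ∀ ℓ {x c} → x < 2 ^ ℓ * c → prefix ℓ x < c
  prefix-< zero    {x} {c} x<c = subst (x <_) (ℕP.+-identityʳ c) x<c
  prefix-< (suc ℓ) {x} {c} x<2^ℓ⁺¹c = ℕD.m<n*o⇒m/o<n (prefix-< ℓ (subst (x <_) regroup x<2^ℓ⁺¹c))
    where
    regroup : 2 ^ suc ℓ * c ≡ 2 ^ ℓ * (c * 2)
    regroup = begin
      2 * 2 ^ ℓ * c   ≡⟨ cong (_* c) (ℕP.*-comm 2 (2 ^ ℓ)) ⟩
      2 ^ ℓ * 2 * c   ≡⟨ ℕP.*-assoc (2 ^ ℓ) 2 c ⟩
      2 ^ ℓ * (2 * c) ≡⟨ cong (2 ^ ℓ *_) (ℕP.*-comm 2 c) ⟩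
      2 ^ ℓ * (c * 2) ∎
      where open ≡-Reasoning

  prefix-top : ∀ n {x} → x < 2 ^ n → prefix n x ≡ 0
  prefix-top n {x} x<2ⁿ = ℕP.n<1⇒n≡0 (prefix-< n (subst (x <_) (sym (ℕP.*-identityʳ (2 ^ n))) x<2ⁿ))

  prefix-agree-above : ∀ {ℓ ℓ'} x y → prefix ℓ x ≡ prefix ℓ y → ℓ ≤ ℓ' → prefix ℓ' x ≡ prefix ℓ' y
  prefix-agree-above {ℓ' = zero}   x y agree z≤n = agree
  prefix-agree-above {ℓ' = suc ℓ'} x y agree ℓ≤ℓ' with ℕP.m≤n⇒m<n∨m≡n ℓ≤ℓ'
  ... | inj₁ (s≤s ℓ≤ℓ'') = cong (_/ 2) (prefix-agree-above x y agree ℓ≤ℓ'')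
  ... | inj₂ refl        = agree

  LowAt : ℕ → ℕ → Set
  LowAt zero    x = ⊤
  LowAt (suc ℓ) x = bit ℓ x ≡ 0

  HighAt : ℕ → ℕ → Set
  HighAt zero    y = ⊤
  HighAt (suc ℓ) y = bit ℓ y ≡ 1

  lowAt? : ∀ ℓ x → Dec (LowAt ℓ x)
  lowAt? zero    x = yes tt
  lowAt? (suc ℓ) x = bit ℓ x ≟ 0

  highAt? : ∀ ℓ y → Dec (HighAt ℓ y)
  highAt? zero    y = yes tt
  highAt? (suc ℓ) y = bit ℓ y ≟ 1

  record SplitsAt (ℓ x y : ℕ) : Set where
    constructor splits
    field
      agree : prefix ℓ x ≡ prefix ℓ y
      low   : LowAt ℓ x
      high  : HighAt ℓ y

  split-below : ∀ ℓ {x y} → SplitsAt (suc ℓ) x y → prefix ℓ x < prefix ℓ y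
  split-below ℓ {x} {y} (splits agree low high) = begin-strict
    prefix ℓ x                          ≡⟨ prefix-digits ℓ x ⟩
    bit ℓ x + prefix (suc ℓ) x * 2      ≡⟨ cong₂ (λ b p → b + p * 2) low agree ⟩
    0 + prefix (suc ℓ) y * 2            <⟨ ℕP.+-monoˡ-< (prefix (suc ℓ) y * 2) (s≤s z≤n) ⟩
    1 + prefix (suc ℓ) y * 2            ≡⟨ cong (λ b → b + prefix (suc ℓ) y * 2) (sym high) ⟩
    bit ℓ y + prefix (suc ℓ) y * 2      ≡⟨ sym (prefix-digits ℓ y) ⟩
    prefix ℓ y                          ∎
    where open ℕP.≤-Reasoning

  splitsAt-sound : ∀ ℓ {x y} → SplitsAt ℓ x y → x ≤ y
  splitsAt-sound zero    split = ℕP.≤-reflexive (SplitsAt.agree split)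
  splitsAt-sound (suc ℓ) split = ℕP.≮⇒≥ λ y<x →
    ℕP.<⇒≱ (split-below ℓ split) (prefix-mono ℓ (ℕP.<⇒≤ y<x))

  -- Above a split the prefixes agree, so the bits there cannot differ.
  no-split-above : ∀ {ℓ ℓ' x y} → SplitsAt ℓ x y → ℓ < ℓ' → ¬ SplitsAt ℓ' x y
  no-split-above {ℓ} {suc ℓ'} {x} {y} split (s≤s ℓ≤ℓ') (splits _ low high) with () ←
    trans (sym low) (trans (cong (_% 2) (prefix-agree-above x y (SplitsAt.agree split) ℓ≤ℓ')) high)

  splitsAt-unique : ∀ {ℓ ℓ' x y} → SplitsAt ℓ x y → SplitsAt ℓ' x y → ℓ ≡ ℓ'
  splitsAt-unique {ℓ} {ℓ'} s s' with ℕP.<-cmp ℓ ℓ'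
  ... | tri< ℓ<ℓ' _ _ with () ← no-split-above s ℓ<ℓ' s'
  ... | tri≈ _ ℓ≡ℓ' _ = ℓ≡ℓ'
  ... | tri> _ _ ℓ>ℓ' with () ← no-split-above s' ℓ>ℓ' s

  -- If x ≤ y and their prefixes agree at level k, they split at some level ≤ k: the
  -- lowest level at which the prefixes still agree.
  split-search : ∀ {x y} → x ≤ y → ∀ k → prefix k x ≡ prefix k y → Σ ℕ λ ℓ → ℓ ≤ k × SplitsAt ℓ x y
  split-search x≤y zero    agree = 0 , z≤n , splits agree tt tt
  split-search {x} {y} x≤y (suc k) agree with prefix k x ≟ prefix k y
  ... | yes agree' with split-search x≤y k agree'
  ...   | ℓ , ℓ≤k , split = ℓ , ℕP.m≤n⇒m≤1+n ℓ≤k , split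
  split-search {x} {y} x≤y (suc k) agree | no differ =
    suc k , ℕP.≤-refl , splits agree (proj₁ bits) (proj₂ bits)
    where
    bits< : bit k x < bit k y
    bits< = ℕP.+-cancelʳ-< (prefix (suc k) x * 2) (bit k x) (bit k y)
      (subst₂ _<_ (prefix-digits k x)
                  (trans (prefix-digits k y) (cong (λ p → bit k y + p * 2) (sym agree)))
                  (ℕP.≤∧≢⇒< (prefix-mono k x≤y) differ))
    zero-one : ∀ a b → a < b → b < 2 → a ≡ 0 × b ≡ 1
    zero-one zero (suc zero) _ _ = refl , refl
    zero-one _ (suc (suc _)) _ (s≤s (s≤s ()))
    zero-one (suc _) (suc zero) (s≤s ()) _
    bits : bit k x ≡ 0 × bit k y ≡ 1
    bits = zero-one (bit k x) (bit k y) bits< (ℕD.m%n<n (prefix k y) 2)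

  splitsAt-exists : ∀ n {x y} → x ≤ y → x < 2 ^ n → y < 2 ^ n → Σ ℕ λ ℓ → ℓ ≤ n × SplitsAt ℓ x y
  splitsAt-exists n x≤y x<2ⁿ y<2ⁿ =
    split-search x≤y n (trans (prefix-top n x<2ⁿ) (sym (prefix-top n y<2ⁿ)))

module Indicators {c ℓ} (K : Field c ℓ) where
  open Field K using (Carrier; _≈_; _+_; _*_; 0#; 1#; refl; trans; +-cong; +-congˡ;
                      +-identityˡ; +-identityʳ; *-identityˡ; zeroˡ)
  import Data.Nat as ℕ
  open import Data.Nat using (zero; suc)
  open import Data.Fin using (Fin; zero; suc; combine; remQuot)
  import Data.Fin.Properties as FinP
  open import Data.Bool using (Bool; true; false; if_then_else_; _∧_; T)
  open import Data.Product using (_×_; uncurry)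
  open import Relation.Nullary using (¬_)
  open import Relation.Binary.PropositionalEquality as ≡ using (_≡_)

  χ : Bool → Carrier
  χ b = if b then 1# else 0#

  χ-∧ : ∀ a b → χ a * χ b ≈ χ (a ∧ b)
  χ-∧ true  true  = *-identityˡ 1#
  χ-∧ true  false = *-identityˡ 0#
  χ-∧ false b     = zeroˡ (χ b)

  sumK-cong : ∀ r {f g : Fin r → Carrier} → (∀ i → f i ≈ g i) → sumK K r f ≈ sumK K r g
  sumK-cong zero    f≈g = refl
  sumK-cong (suc r) f≈g = +-cong (f≈g zero) (sumK-cong r (λ i → f≈g (suc i)))

  sum-χ-none : ∀ r (F : Fin r → Bool) → (∀ i → ¬ T (F i)) → sumK K r (λ i → χ (F i)) ≈ 0#
  sum-χ-none zero    F none = refl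
  sum-χ-none (suc r) F none with F zero | none zero
  ... | true  | ¬true with () ← ¬true _
  ... | false | _     = trans (+-identityˡ _) (sum-χ-none r (λ i → F (suc i)) (λ i → none (suc i)))

  sum-χ-one : ∀ r (F : Fin r → Bool) i₀ → T (F i₀) → (∀ i → T (F i) → i ≡ i₀) →
              sumK K r (λ i → χ (F i)) ≈ 1#
  sum-χ-one (suc r) F zero F-i₀ only with F zero
  ... | true = trans (+-congˡ (sum-χ-none r (λ i → F (suc i)) (λ i Fi → zero≢suc (only (suc i) Fi))))
                     (+-identityʳ 1#)
    where
    zero≢suc : ∀ {i : Fin r} → ¬ suc i ≡ zero
    zero≢suc ()
  sum-χ-one (suc r) F (suc i₀) F-i₀ only with F zero | only zero
  ... | true  | zero≡suc with () ← zero≡suc _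
  ... | false | _ = trans (+-identityˡ _)
                      (sum-χ-one r (λ i → F (suc i)) i₀ F-i₀
                                 (λ i Fi → FinP.suc-injective (only (suc i) Fi)))

  sum-χ-one-pair : ∀ m p (F : Fin m × Fin p → Bool) x₀ → T (F x₀) → (∀ x → T (F x) → x ≡ x₀) →
                   sumK K (m ℕ.* p) (λ c → χ (F (remQuot p c))) ≈ 1#
  sum-χ-one-pair m p F x₀ F-x₀ only =
    sum-χ-one (m ℕ.* p) (λ c → F (remQuot p c)) (uncurry combine x₀)
      (≡.subst (λ x → T (F x)) (≡.sym (FinP.remQuot-combine {m} {p} _ _)) F-x₀)
      (λ c Fc → ≡.trans (≡.sym (FinP.combine-remQuot {m} p c))
                        (≡.cong (uncurry combine) (only (remQuot p c) Fc)))

-- It agrees with LEQ at (x,y)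
-- whenever h_k separates the prefixes of x and y, which fails for at most (n+1)/t of all k.
module RandomMatrix {c ℓ} (K : Field c ℓ) (n t : ℕ) where
  open Field K using (_≈_; _*_) renaming (refl to ≈-refl; trans to ≈-trans; reflexive to ≈-reflexive)
  open Indicators K
  open Counting
  open UniformHashing t
  open BinaryPrefixes
  import Data.Nat as ℕ
  open import Data.Nat using (suc; _^_; _≤_; _≤ᵇ_; s≤s; z≤n)
  import Data.Nat.Properties as ℕP
  open import Data.Fin using (Fin; toℕ; fromℕ<; remQuot)
  open import Data.Fin.Properties using (_≟_; toℕ<n; toℕ-fromℕ<; toℕ-injective)
  open import Data.Fin.Subset using (Subset; _∈_; ∣_∣)
  open import Data.Bool using (Bool; true; false; not; _∧_; T)
  open import Data.Bool.Properties using (T-∧; T-not-≡)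
  open import Data.Vec using (tabulate)
  open import Data.Product using (Σ; _×_; _,_; proj₁; proj₂)
  open import Function using (Equivalence)
  open import Relation.Nullary using (¬_; Dec; yes; no)
  open import Relation.Nullary.Decidable
    using (⌊_⌋; _×-dec_; ¬?; toWitness; fromWitness; decidable-stable)
  open import Relation.Binary.PropositionalEquality

  D = 2 ^ n
  L = suc n
  N = t ^ D      -- number of hash functions
  r = L ℕ.* t

  prefixAt : Fin L → Fin D → Fin D
  prefixAt l x = fromℕ< (ℕP.≤-<-trans (prefix-≤ (toℕ l) (toℕ x)) (toℕ<n x))

  prefixAt-agree : ∀ l x y → prefixAt l x ≡ prefixAt l y →
                   prefix (toℕ l) (toℕ x) ≡ prefix (toℕ l) (toℕ y)
  prefixAt-agree l x y e = trans (sym (toℕ-fromℕ< _)) (trans (cong toℕ e) (toℕ-fromℕ< _))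

  agree-prefixAt : ∀ l x y → prefix (toℕ l) (toℕ x) ≡ prefix (toℕ l) (toℕ y) →
                   prefixAt l x ≡ prefixAt l y
  agree-prefixAt l x y e = toℕ-injective (trans (toℕ-fromℕ< _) (trans e (sym (toℕ-fromℕ< _))))

  left : Fin N → Fin D → Fin L × Fin t → Bool
  left k x (l , s) = ⌊ (hash k (prefixAt l x) ≟ s) ×-dec lowAt? (toℕ l) (toℕ x) ⌋

  right : Fin N → Fin D → Fin L × Fin t → Bool
  right k y (l , s) = ⌊ (hash k (prefixAt l y) ≟ s) ×-dec highAt? (toℕ l) (toℕ y) ⌋

  selected : Fin N → Fin D → Fin D → Fin L × Fin t → Bool
  selected k x y p = left k x p ∧ right k y p

  selected-elim : ∀ {k x y} p → T (selected k x y p) → T (left k x p) × T (right k y p)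
  selected-elim {k} {x} {y} p = Equivalence.to (T-∧ {left k x p} {right k y p})

  selected-intro : ∀ {k x y} p → T (left k x p) → T (right k y p) → T (selected k x y p)
  selected-intro {k} {x} {y} p Tl Tr = Equivalence.from (T-∧ {left k x p} {right k y p}) (Tl , Tr)

  M : Fin N → Matrix K D D
  M k x y = sumK K r (λ c → χ (left k x (remQuot t c)) * χ (right k y (remQuot t c)))

  M-rank : ∀ k → RankAtMost K (M k) r
  M-rank k = (λ x c → χ (left k x (remQuot t c))) , (λ c y → χ (right k y (remQuot t c))) ,
             λ x y → ≈-refl

  Separates : Fin N → Fin D → Fin D → Set
  Separates k x y = ∀ l → hash k (prefixAt l x) ≡ hash k (prefixAt l y) → prefixAt l x ≡ prefixAt l y

  selected-splits : ∀ {k x y l s} → Separates k x y → T (selected k x y (l , s)) →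
                    SplitsAt (toℕ l) (toℕ x) (toℕ y) × hash k (prefixAt l x) ≡ s
  selected-splits {k} {x} {y} {l} {s} sep sel with selected-elim (l , s) sel
  ... | sel-x , sel-y with toWitness sel-x | toWitness sel-y
  ... | hx , low | hy , high =
    splits (prefixAt-agree l x y (sep l (trans hx (sym hy)))) low high , hx

  splits-selected : ∀ {k x y l} → SplitsAt (toℕ l) (toℕ x) (toℕ y) →
                    T (selected k x y (l , hash k (prefixAt l x)))
  splits-selected {k} {x} {y} {l} (splits agree low high) = selected-intro (l , hash k (prefixAt l x))
    (fromWitness (refl , low))
    (fromWitness (cong (hash k) (agree-prefixAt l y x (sym agree)) , high))

  selection-unique : ∀ {k x y p p'} → Separates k x y →
                     T (selected k x y p) → T (selected k x y p') → p ≡ p'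
  selection-unique {k} {x} {p = l , s} {l' , s'} sep sel sel'
    with selected-splits sep sel | selected-splits sep sel'
  ... | split , hash≡s | split' , hash≡s'
    with toℕ-injective {i = l} {j = l'} (splitsAt-unique split split')
  ... | refl = cong (l ,_) (trans (sym hash≡s) hash≡s')

  LEQ-≤ : ∀ x y → toℕ x ≤ toℕ y → LEQ K n x y ≡ Field.1# K
  LEQ-≤ x y x≤y with toℕ x ≤ᵇ toℕ y | ℕP.≤⇒≤ᵇ x≤y
  ... | true | _ = refl

  LEQ-≰ : ∀ x y → ¬ toℕ x ≤ toℕ y → LEQ K n x y ≡ Field.0# K
  LEQ-≰ x y x≰y with toℕ x ≤ᵇ toℕ y in le
  ... | true  with () ← x≰y (ℕP.≤ᵇ⇒≤ (toℕ x) (toℕ y) (subst T (sym le) _))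
  ... | false = refl

  -- A separating hash function yields the correct entry: for x ≤ y exactly one index is
  -- selected (the splitting level), for x > y none.
  M-correct : ∀ k x y → Separates k x y → M k x y ≈ LEQ K n x y
  M-correct k x y sep = ≈-trans (sumK-cong r (λ c → χ-∧ _ _)) entry
    where
    entry : sumK K r (λ c → χ (selected k x y (remQuot t c))) ≈ LEQ K n x y
    entry with toℕ x ℕP.≤? toℕ y
    ... | no x≰y = ≈-trans
            (sum-χ-none r _ λ c sel → x≰y (splitsAt-sound _ (proj₁ (selected-splits sep sel))))
            (≈-reflexive (sym (LEQ-≰ x y x≰y)))
    ... | yes x≤y with splitsAt-exists n x≤y (toℕ<n x) (toℕ<n y)
    ...   | ℓ , ℓ≤n , split = ≈-trans
            (sum-χ-one-pair L t (selected k x y) (l , hash k (prefixAt l x)) (splits-selected split-at-l)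
              (λ p sel → selection-unique sep sel (splits-selected split-at-l)))
            (≈-reflexive (sym (LEQ-≤ x y x≤y)))
      where
      l : Fin L
      l = fromℕ< (s≤s ℓ≤n)
      split-at-l : SplitsAt (toℕ l) (toℕ x) (toℕ y)
      split-at-l = subst (λ ℓ → SplitsAt ℓ (toℕ x) (toℕ y)) (sym (toℕ-fromℕ< (s≤s ℓ≤n))) split

  collides : Fin D → Fin D → Fin N → Fin L → Bool
  collides x y k l =
    ⌊ (hash k (prefixAt l x) ≟ hash k (prefixAt l y)) ×-dec ¬? (prefixAt l x ≟ prefixAt l y) ⌋

  bad : Fin D → Fin D → Fin N → Bool
  bad x y k = anyF L (collides x y k)

  good-separates : ∀ x y k → T (not (bad x y k)) → Separates k x y
  good-separates x y k good l hash≡ = decidable-stable (prefixAt l x ≟ prefixAt l y) λ differ →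
    subst T (Equivalence.to T-not-≡ good)
            (anyF-intro L (collides x y k) l (fromWitness (hash≡ , differ)))

  collisions-rare : ∀ x y l → count N (λ k → collides x y k l) ℕ.* t ≤ N
  collisions-rare x y l = by-prefixes (prefixAt l x ≟ prefixAt l y)
    where
    by-prefixes : Dec (prefixAt l x ≡ prefixAt l y) → count N (λ k → collides x y k l) ℕ.* t ≤ N
    by-prefixes (yes same) = ℕP.≤-trans (ℕP.*-monoˡ-≤ t never) z≤n
      where
      never : count N (λ k → collides x y k l) ≤ 0
      never = ℕP.≤-trans (count-mono N (λ k c → proj₂ (toWitness c) same))
                         (ℕP.≤-reflexive (count-const N false))
    by-prefixes (no differ) = ℕP.≤-trans
      (ℕP.*-monoˡ-≤ t (count-mono N (λ k c → fromWitness (proj₁ (toWitness c)))))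
      (hash-collision D (prefixAt l x) (prefixAt l y) differ)

  bad-rare : ∀ x y → count N (bad x y) ℕ.* t ≤ L ℕ.* N
  bad-rare x y = ℕP.≤-trans
    (ℕP.*-monoˡ-≤ t (count-anyF N L (collides x y)))
    (sumF-bound L t N (λ l → count N (λ k → collides x y k l)) (collisions-rare x y))

  good-hashes : ∀ x y → Σ (Subset N) λ S →
                (∀ k → k ∈ S → M k x y ≈ LEQ K n x y) × ∣ S ∣ ℕ.+ count N (bad x y) ≡ N
  good-hashes x y =
    tabulate (λ k → not (bad x y k)) ,
    (λ k k∈S → M-correct k x y (good-separates x y k (∈-tabulate _ k k∈S))) ,
    trans (cong (ℕ._+ count N (bad x y)) (∣tabulate∣ N _)) (count-not N (bad x y))

module Parameters where
  open import Data.Nat using (ℕ; suc; _+_; _*_; _/_; _%_; _≤_; _<_; NonZero)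
  import Data.Nat.Properties as ℕP
  import Data.Nat.DivMod as ℕD
  open import Data.Nat.Solver using (module +-*-Solver)
  open +-*-Solver using (solve; _:+_; _:*_; _:=_; con)
  open import Relation.Binary.PropositionalEquality

  buckets : (L q a : ℕ) .{{_ : NonZero a}} → ℕ
  buckets L q a = suc (L * q / a)

  -- L / t < a / q: the union bound over the L levels stays below ε.
  buckets-large : ∀ L q a .{{_ : NonZero a}} → L * q < buckets L q a * a
  buckets-large L q a = begin-strict
    L * q                       ≡⟨ ℕD.m≡m%n+[m/n]*n (L * q) a ⟩
    L * q % a + L * q / a * a   <⟨ ℕP.+-monoˡ-< (L * q / a * a) (ℕD.m%n<n (L * q) a) ⟩
    a + L * q / a * a           ∎
    where open ℕP.≤-Reasoning

  buckets-small : ∀ L q a .{{_ : NonZero a}} → a ≤ q → buckets L q a * a ≤ suc L * q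
  buckets-small L q a a≤q = ℕP.+-mono-≤ a≤q (ℕD.m/n*n≤m (L * q) a)

  fraction-transfer : ∀ bad N L t q a .{{_ : NonZero t}} →
                      bad * t ≤ L * N → L * q ≤ t * a → bad * q ≤ a * N
  fraction-transfer bad N L t q a bad≤ L/t≤a/q = ℕP.*-cancelʳ-≤ (bad * q) (a * N) t (begin
    bad * q * t     ≡⟨ solve 3 (λ b q t → b :* q :* t := q :* (b :* t)) refl bad q t ⟩
    q * (bad * t)   ≤⟨ ℕP.*-monoʳ-≤ q bad≤ ⟩
    q * (L * N)     ≡⟨ solve 3 (λ q L N → q :* (L :* N) := L :* q :* N) refl q L N ⟩
    L * q * N       ≤⟨ ℕP.*-monoˡ-≤ N L/t≤a/q ⟩
    t * a * N       ≡⟨ solve 3 (λ t a N → t :* a :* N := a :* N :* t) refl t a N ⟩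
    a * N * t       ∎)
    where open ℕP.≤-Reasoning

  levels-bound : ∀ m → suc (suc m) * suc (suc (suc m)) ≤ 6 * (suc m * suc m)
  levels-bound m = subst (suc (suc m) * suc (suc (suc m)) ≤_)
    (solve 1 (λ m → (con 2 :+ m) :* (con 3 :+ m) :+ (con 5 :* m :* m :+ con 7 :* m)
                   := con 6 :* ((con 1 :+ m) :* (con 1 :+ m))) refl m)
    (ℕP.m≤m+n (suc (suc m) * suc (suc (suc m))) (5 * m * m + 7 * m))

  rank-bound : ∀ m q a .{{_ : NonZero a}} → a ≤ q →
               suc (suc m) * buckets (suc (suc m)) q a * a ≤ 6 * (suc m * suc m) * q
  rank-bound m q a a≤q = begin
    L * t * a         ≡⟨ ℕP.*-assoc L t a ⟩
    L * (t * a)       ≤⟨ ℕP.*-monoʳ-≤ L (buckets-small L q a a≤q) ⟩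
    L * (suc L * q)   ≡⟨ sym (ℕP.*-assoc L (suc L) q) ⟩
    L * suc L * q     ≤⟨ ℕP.*-monoˡ-≤ q (levels-bound m) ⟩
    6 * (suc m * suc m) * q ∎
    where
    open ℕP.≤-Reasoning
    L = suc (suc m)
    t = buckets L q a

open NaturalsInRationals
open Parameters
open Counting using (count)
import Data.Nat as ℕ
import Data.Nat.Properties as ℕP
open import Data.Nat using (zero; suc)
open import Data.Integer using (+_; -[1+_]; +<+)
open import Data.Rational as ℚ using (mkℚ; 1ℚ; *<*)
open import Data.Nat.Coprimality using (Coprime)
open import Data.Fin.Subset using (Subset; _∈_; ∣_∣)
open import Data.Product using (Σ; _×_; _,_)

LEQ-probabilistic-rank : ∀ {c ℓ} (K : Field c ℓ) m a-1 q-1 .(cop : Coprime (suc a-1) (suc q-1)) →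
  suc a-1 ℕ.≤ suc q-1 →
  let n = suc m ; ε = mkℚ (+ suc a-1) q-1 cop in
  Σ ℕ λ r → (⟦ r ⟧ ℚ.* ε ℚ.≤ ⟦ 6 ℕ.* (n ℕ.* n) ⟧) × ProbRankAtMost K (LEQ K n) ε r
LEQ-probabilistic-rank K m a-1 q-1 cop a≤q =
  r , scaled-bound a q-1 cop r (6 ℕ.* (n ℕ.* n)) (rank-bound m q a a≤q) ,
  N , ℕP.m^n≢0 t D , M , M-rank , error-bound
  where
  n = suc m
  a = suc a-1
  q = suc q-1
  t = buckets (suc n) q a
  open RandomMatrix K n t
  error-bound : ∀ x y → Σ (Subset N) λ S → (∀ k → k ∈ S → Field._≈_ K (M k x y) (LEQ K n x y)) ×
                ((1ℚ ℚ.- mkℚ (+ a) q-1 cop) ℚ.* ⟦ N ⟧ ℚ.≤ ⟦ ∣ S ∣ ⟧)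
  error-bound x y with good-hashes x y
  ... | S , correct , size = S , correct ,
    complement-bound a q-1 cop ∣ S ∣ (count N (bad x y)) N size
      (fraction-transfer (count N (bad x y)) N (suc n) t q a
        (bad-rare x y) (ℕP.<⇒≤ (buckets-large (suc n) q a)))

-- Lemma D.2: the ε-probabilistic rank of LEQ_n is at most 6n²/ε over every field.  Write
-- ε = a/q in lowest terms; 0 < ε rules out a ≤ 0 and ε < 1 gives a < q.
lemmaD2 : LEQBound
LEQBound.C     lemmaD2 = 6
LEQBound.bound lemmaD2 K zero ()
LEQBound.bound lemmaD2 K (suc m) _ (mkℚ (+ suc a-1) q-1 cop) _ ε<1 =
  LEQ-probabilistic-rank K m a-1 q-1 cop (ℕP.<⇒≤ (numerator-< (suc a-1) q-1 cop ε<1))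
LEQBound.bound lemmaD2 K (suc m) _ (mkℚ (+ zero) _ _) (*<* (+<+ ())) _
LEQBound.bound lemmaD2 K (suc m) _ (mkℚ -[1+ _ ] _ _) (*<* ()) _
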